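{- There is a function $C_1(t,\epsilon)$ such that the following holds for all $t\in\mathbb{N}$ and $\epsilon\in(0,1)$: if $G$ is a bipartite graph with parts $A,B$ which is $\overline{K_{t,t}}$-free and $|B|\geq \epsilon^{ -1}t$, then $A$ contains at most $C_1(t,\epsilon)$ vertices of degree at most $(1-\epsilon)|B|$.
   Context: A bipartite graph with parts $A,B$ is called $\overline{K_{t,t}}$-free if for every $A_0\subseteq A$ and $B_0\subseteq B$ with $|A_0|=|B_0|=t$ there is an edge between $A_0$ and $B_0$ (equivalently, the bipartite complement is $K_{t,t}$-free).
   Formalization: The parameter ε ranges over the rationals in the interval (0,1), so the function $C_1(t,\epsilon)$ is defined only for rational ε. -}

module Defs where

open import Data.Nat using (ℕ)
open import Data.Bool using (Bool; true; false)
open import Data.Fin using (Fin)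
open import Data.Fin.Subset using (Subset; _∈_; ∣_∣)
open import Data.Vec using (tabulate; count)
open import Data.Product using (Σ; _×_; ∃-syntax)
open import Relation.Binary.PropositionalEquality using (_≡_)
open import Relation.Nullary.Decidable using (Dec)
open import Data.Bool using (T)
open import Data.Bool.Properties using (T?)

-- A bipartite graph with parts A = Fin m and B = Fin n,
-- given by its biadjacency relation (edge a b = true iff ab is an edge).
BipGraph : ℕ → ℕ → Set
BipGraph m n = Fin m → Fin n → Bool

CoKttFree : ∀ {m n} → ℕ → BipGraph m n → Set
CoKttFree {m} {n} t G =
  (A₀ : Subset m) (B₀ : Subset n) → ∣ A₀ ∣ ≡ t → ∣ B₀ ∣ ≡ t →
  ∃[ a ] ∃[ b ] (a ∈ A₀ × b ∈ B₀ × G a b ≡ true)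

deg : ∀ {m n} → BipGraph m n → Fin m → ℕ
deg G a = count (λ b → T? (G a b)) (tabulate (λ b → b))

open import Data.Integer using (+_)
open import Data.Rational using (ℚ; _/_)

ℚ[_] : ℕ → ℚ
ℚ[ k ] = (+ k) / 1

-- Write ε = p/d and let S be the set of vertices of A of degree at most (1 - ε)|B|. Every a ∈ S
-- has at least ε|B| ≥ |B|/d non-neighbours, and at least t of them since t ≤ ε|B|. Choose
-- b₁, …, b_t ∈ B greedily, keeping the set Sⱼ ⊆ S of common non-neighbours of b₁, …, bⱼ: since
-- j < t, each a ∈ Sⱼ still has at least |B|/(dt) non-neighbours outside {b₁, …, bⱼ}, so by double
-- counting some new b_{j+1} is a non-neighbour of at least |Sⱼ|/(dt) vertices of Sⱼ. No edge joins
-- S_t to {b₁, …, b_t}, so |S_t| < t by $\overline{K_{t,t}}$-freeness, whence |S| ≤ (dt)^t |S_t| ≤ t (dt)^t.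
module Submission where

-- Subsets of Fin k are represented by characteristic functions rather than Data.Fin.Subset, so that
-- cardinalities are finite sums and double counting is ∑-comm.
module Cardinality where
  open import Data.Bool.Base using (Bool; true; false; not; _∧_)
  open import Data.Fin.Base using (Fin; zero; suc)
  open import Data.Nat.Base
  open import Data.Nat.Properties hiding (_≟_)
  open import Data.Product.Base using (_×_; _,_; ∃-syntax)
  open import Data.Sum.Base using (_⊎_; inj₁; inj₂)
  open import Data.Fin.Properties using (_≟_)
  open import Data.Vec.Functional using (_∷_; updateAt)
  open import Data.Vec.Functional.Properties using (updateAt-minimal)
  open import Function.Base using (_∘_)
  open import Relation.Nullary.Decidable.Core using (yes; no)
  open import Relation.Binary.PropositionalEquality

  open import Algebra.Properties.Semiring.Sum +-*-semiring public
    using (sum; sum-cong-≗; ∑-comm; ∑-distrib-+; *-distribˡ-sum)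

  sum-mono-≤ : ∀ {k} {f g : Fin k → ℕ} → (∀ i → f i ≤ g i) → sum f ≤ sum g
  sum-mono-≤ {zero}  f≤g = z≤n
  sum-mono-≤ {suc k} f≤g = +-mono-≤ (f≤g zero) (sum-mono-≤ (f≤g ∘ suc))

  sum-const : ∀ k c → sum {k} (λ _ → c) ≡ k * c
  sum-const zero    c = refl
  sum-const (suc k) c = cong (c +_) (sum-const k c)

  argmax : ∀ {k} (f : Fin (suc k) → ℕ) → ∃[ i ] (∀ j → f j ≤ f i)
  argmax {zero}  f = zero , λ { zero → ≤-refl }
  argmax {suc k} f with argmax (f ∘ suc)
  ... | i , max with ≤-total (f zero) (f (suc i))
  ...   | inj₁ f₀≤ = suc i , λ { zero → f₀≤    ; (suc j) → max j }
  ...   | inj₂ ≤f₀ = zero  , λ { zero → ≤-refl ; (suc j) → ≤-trans (max j) ≤f₀ }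

  ∃-sum≤size*term : ∀ {k} .{{_ : NonZero k}} (f : Fin k → ℕ) → ∃[ i ] (sum f ≤ k * f i)
  ∃-sum≤size*term {suc k} f with argmax f
  ... | i , max = i , ≤-trans (sum-mono-≤ max) (≤-reflexive (sum-const (suc k) (f i)))

  𝟙 : Bool → ℕ
  𝟙 true  = 1
  𝟙 false = 0

  card : ∀ {k} → (Fin k → Bool) → ℕ
  card p = sum (𝟙 ∘ p)

  _⊆_ : ∀ {k} → (Fin k → Bool) → (Fin k → Bool) → Set
  p ⊆ q = ∀ i → p i ≡ true → q i ≡ true

  card-∅ : ∀ k → card {k} (λ _ → false) ≡ 0
  card-∅ zero    = refl
  card-∅ (suc k) = card-∅ k

  card≤size : ∀ {k} (p : Fin k → Bool) → card p ≤ k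
  card≤size {zero}  p = z≤n
  card≤size {suc k} p with p zero
  ... | true  = s≤s (card≤size (p ∘ suc))
  ... | false = m≤n⇒m≤1+n (card≤size (p ∘ suc))

  card>0⇒nonempty : ∀ {k} (p : Fin k → Bool) → 0 < card p → ∃[ i ] p i ≡ true
  card>0⇒nonempty {suc k} p 0<∣p∣ with p zero in p₀
  ... | true  = zero , p₀
  ... | false with card>0⇒nonempty (p ∘ suc) 0<∣p∣
  ...   | i , pᵢ = suc i , pᵢ

  card+card-not : ∀ {k} (p : Fin k → Bool) → card p + card (not ∘ p) ≡ k
  card+card-not {zero}  p = refl
  card+card-not {suc k} p with p zero
  ... | true  = cong suc (card+card-not (p ∘ suc))
  ... | false = trans (+-suc (card (p ∘ suc)) _) (cong suc (card+card-not (p ∘ suc)))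

  card≤card-outside+card : ∀ {k} (p q : Fin k → Bool) →
                            card q ≤ card (λ i → not (p i) ∧ q i) + card p
  card≤card-outside+card p q =
    ≤-trans (sum-mono-≤ pointwise) (≤-reflexive (∑-distrib-+ (λ i → 𝟙 (not (p i) ∧ q i)) (𝟙 ∘ p)))
    where
    pointwise : ∀ i → 𝟙 (q i) ≤ 𝟙 (not (p i) ∧ q i) + 𝟙 (p i)
    pointwise i with p i | q i
    ... | true  | true  = s≤s z≤n
    ... | true  | false = z≤n
    ... | false | true  = s≤s z≤n
    ... | false | false = z≤n

  subset-of-card : ∀ {k} (p : Fin k → Bool) t → t ≤ card p → ∃[ q ] (q ⊆ p × card q ≡ t)
  subset-of-card {k}     p zero    _ = (λ _ → false) , (λ _ ()) , card-∅ k
  subset-of-card {suc k} p (suc t) t<∣p∣ with p zero in p₀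
  ... | true with subset-of-card (p ∘ suc) t (s≤s⁻¹ t<∣p∣)
  ...   | q , q⊆p , ∣q∣≡t = (true ∷ q) , (λ { zero _ → p₀ ; (suc i) → q⊆p i }) , cong suc ∣q∣≡t
  subset-of-card {suc k} p (suc t) t<∣p∣ | false with subset-of-card (p ∘ suc) (suc t) t<∣p∣
  ...   | q , q⊆p , ∣q∣≡t = (false ∷ q) , (λ { zero () ; (suc i) → q⊆p i }) , ∣q∣≡t

  card-updateAt-true : ∀ {k} (p : Fin k → Bool) i → p i ≡ false →
                       card (updateAt p i (λ _ → true)) ≡ suc (card p)
  card-updateAt-true p zero    pᵢ rewrite pᵢ = refl
  card-updateAt-true p (suc i) pᵢ =
    trans (cong (𝟙 (p zero) +_) (card-updateAt-true (p ∘ suc) i pᵢ)) (+-suc _ _)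

  updateAt-true⁻ : ∀ {k} (p : Fin k → Bool) i j → updateAt p i (λ _ → true) j ≡ true →
                    p j ≡ true ⊎ j ≡ i
  updateAt-true⁻ p i j pⱼ with j ≟ i
  ... | yes j≡i = inj₂ j≡i
  ... | no  j≢i = inj₁ (trans (sym (updateAt-minimal j i p j≢i)) pⱼ)

module CoKttFreeGraphs where
  open import Data.Bool.Base using (Bool; true; false; not; _∧_)
  open import Data.Bool.Properties using (∧-conicalˡ; ∧-conicalʳ; not-injective; T?)
  import Data.Bool.Properties as Bool
  open import Data.Empty using (⊥; ⊥-elim)
  open import Relation.Nullary.Negation.Core using (contradiction)
  open import Data.Fin.Base using (Fin; zero; suc)
  open import Data.Fin.Subset using (_∈_; ∣_∣)
  open import Data.Nat.Base
  open import Data.Nat.Properties hiding (_≟_)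
  open import Algebra.Properties.CommutativeSemigroup *-commutativeSemigroup using (x∙yz≈y∙xz)
  open import Data.Product.Base using (_×_; _,_; proj₁; proj₂; ∃-syntax)
  open import Data.Sum.Base using (inj₁; inj₂)
  open import Data.Vec.Base using (tabulate; count)
  open import Data.Vec.Functional using (updateAt)
  open import Data.Vec.Properties using (lookup∘tabulate; []=⇒lookup)
  open import Function.Base using (_∘_)
  open import Relation.Binary.PropositionalEquality
  open import Relation.Nullary.Decidable.Core using (does; yes; no)
  open import Relation.Unary using (Pred; Decidable)
  open import Defs
  open Cardinality
  open ≤-Reasoning

  count-tabulate : ∀ {a p} {A : Set a} {P : Pred A p} (P? : Decidable P) {k} (f : Fin k → A) →
                   count P? (tabulate f) ≡ card (λ i → does (P? (f i)))
  count-tabulate P? {zero}  f = refl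
  count-tabulate P? {suc k} f with does (P? (f zero))
  ... | true  = cong suc (count-tabulate P? (f ∘ suc))
  ... | false = count-tabulate P? (f ∘ suc)

  ∣tabulate∣≡card : ∀ {k} (p : Fin k → Bool) → ∣ tabulate p ∣ ≡ card p
  ∣tabulate∣≡card p =
    trans (count-tabulate (Bool._≟ true) p) (sum-cong-≗ (cong 𝟙 ∘ does-≟-true ∘ p))
    where
    does-≟-true : ∀ x → does (x Bool.≟ true) ≡ x
    does-≟-true true  = refl
    does-≟-true false = refl

  ∈tabulate⇒ : ∀ {k} (p : Fin k → Bool) {i} → i ∈ tabulate p → p i ≡ true
  ∈tabulate⇒ p {i} i∈p = trans (sym (lookup∘tabulate p i)) ([]=⇒lookup i∈p)

  nondeg : ∀ {m n} → BipGraph m n → Fin m → ℕ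
  nondeg G a = card (λ b → not (G a b))

  deg+nondeg : ∀ {m n} (G : BipGraph m n) a → deg G a + nondeg G a ≡ n
  deg+nondeg G a = trans (cong (_+ nondeg G a) (count-tabulate (T? ∘ G a) (λ b → b))) (card+card-not (G a))

  CoKttFree⇒edge : ∀ {m n t} {G : BipGraph m n} → CoKttFree t G →
                   (A₀ : Fin m → Bool) (B₀ : Fin n → Bool) → card A₀ ≡ t → card B₀ ≡ t →
                   ∃[ a ] ∃[ b ] (A₀ a ≡ true × B₀ b ≡ true × G a b ≡ true)
  CoKttFree⇒edge free A₀ B₀ ∣A₀∣≡t ∣B₀∣≡t
    with free (tabulate A₀) (tabulate B₀)
              (trans (∣tabulate∣≡card A₀) ∣A₀∣≡t) (trans (∣tabulate∣≡card B₀) ∣B₀∣≡t)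
  ... | a , b , a∈A₀ , b∈B₀ , Gab = a , b , ∈tabulate⇒ A₀ a∈A₀ , ∈tabulate⇒ B₀ b∈B₀ , Gab

  0<m≤n*o⇒0<o : ∀ {m} n {o} → 0 < m → m ≤ n * o → 0 < o
  0<m≤n*o⇒0<o n {zero}  0<m m≤n*0 = contradiction (≤-trans m≤n*0 (≤-reflexive (*-zeroʳ n))) (<⇒≱ 0<m)
  0<m≤n*o⇒0<o n {suc _} _   _     = z<s

  m≤n+o∧o<p≤m⇒m≤p*n : ∀ {m n o p} → m ≤ n + o → o < p → p ≤ m → m ≤ p * n
  m≤n+o∧o<p≤m⇒m≤p*n {n = zero}  m≤o      o<p p≤m = ⊥-elim (<⇒≱ o<p (≤-trans p≤m m≤o))
  m≤n+o∧o<p≤m⇒m≤p*n {n = suc n} {p = suc p} m≤n+o o<p _ =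
    ≤-trans m≤n+o (+-monoʳ-≤ (suc n) (≤-trans (s≤s⁻¹ o<p) (m≤m*n p (suc n))))

  module _ {m n} (G : BipGraph m n) (t d : ℕ) (S : Fin m → Bool)
           (S-large-nondeg : ∀ a → S a ≡ true → t ≤ nondeg G a × n ≤ d * nondeg G a) where

    many-non-neighbours-outside : ∀ {a} → S a ≡ true → (T : Fin n → Bool) → card T < t →
                                  n ≤ d * t * card (λ b → not (T b) ∧ not (G a b))
    many-non-neighbours-outside {a} Sa T ∣T∣<t = begin
      n                                              ≤⟨ n≤d*nondeg ⟩
      d * nondeg G a                                 ≤⟨ *-monoʳ-≤ d nondeg≤t*outside ⟩
      d * (t * card (λ b → not (T b) ∧ not (G a b))) ≡⟨ *-assoc d t _ ⟨
      d * t * card (λ b → not (T b) ∧ not (G a b))   ∎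
      where
      t≤nondeg = proj₁ (S-large-nondeg a Sa)
      n≤d*nondeg = proj₂ (S-large-nondeg a Sa)
      nondeg≤t*outside =
        m≤n+o∧o<p≤m⇒m≤p*n (card≤card-outside+card T (λ b → not (G a b))) ∣T∣<t t≤nondeg

    common-non-neighbour : (S′ : Fin m → Bool) → S′ ⊆ S → 0 < card S′ →
                           (T : Fin n → Bool) → card T < t →
                           ∃[ b ] (T b ≡ false × card S′ ≤ d * t * card (λ a → S′ a ∧ not (G a b)))
    common-non-neighbour S′ S′⊆S 0<∣S′∣ T ∣T∣<t = outside-T b ∣S′∣≤K*col[b]
      where
      K = d * t
      nonEdge : Fin m → Fin n → Bool
      nonEdge a b = not (T b) ∧ (S′ a ∧ not (G a b))

      col : Fin n → ℕ
      col b = card (λ a → nonEdge a b)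

      row-bound : ∀ a → n * 𝟙 (S′ a) ≤ K * card (λ b → not (T b) ∧ (S′ a ∧ not (G a b)))
      row-bound a with S′ a in S′a
      ... | false = ≤-trans (≤-reflexive (*-zeroʳ n)) z≤n
      ... | true  = ≤-trans (≤-reflexive (*-identityʳ n))
                              (many-non-neighbours-outside (S′⊆S a S′a) T ∣T∣<t)

      double-count : n * card S′ ≤ K * sum col
      double-count = begin
        n * card S′                       ≡⟨ *-distribˡ-sum n (𝟙 ∘ S′) ⟩
        sum (λ a → n * 𝟙 (S′ a))          ≤⟨ sum-mono-≤ row-bound ⟩
        sum (λ a → K * card (nonEdge a))  ≡⟨ *-distribˡ-sum K (λ a → card (nonEdge a)) ⟨
        K * sum (λ a → card (nonEdge a))  ≡⟨ cong (K *_) (∑-comm (λ a b → 𝟙 (nonEdge a b))) ⟩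
        K * sum col                       ∎

      0<n : 0 < n
      0<n with card>0⇒nonempty S′ 0<∣S′∣
      ... | a , S′a = <-≤-trans (≤-<-trans z≤n ∣T∣<t)
                        (≤-trans (proj₁ (S-large-nondeg a (S′⊆S a S′a))) (card≤size (λ b → not (G a b))))

      instance _ = >-nonZero 0<n
      b = proj₁ (∃-sum≤size*term col)

      ∣S′∣≤K*col[b] : card S′ ≤ K * col b
      ∣S′∣≤K*col[b] = *-cancelˡ-≤ n (begin
        n * card S′      ≤⟨ double-count ⟩
        K * sum col      ≤⟨ *-monoʳ-≤ K (proj₂ (∃-sum≤size*term col)) ⟩
        K * (n * col b)  ≡⟨ x∙yz≈y∙xz K n (col b) ⟩
        n * (K * col b)  ∎)

      outside-T : ∀ b → card S′ ≤ K * card (λ a → not (T b) ∧ (S′ a ∧ not (G a b))) →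
                  ∃[ b ] (T b ≡ false × card S′ ≤ K * card (λ a → S′ a ∧ not (G a b)))
      outside-T b ∣S′∣≤ with T b in Tb
      ... | false = b , Tb , ∣S′∣≤
      ... | true  = contradiction (card-∅ m) (>⇒≢ (0<m≤n*o⇒0<o K 0<∣S′∣ ∣S′∣≤))

    record Stage (j : ℕ) : Set where
      field
        rows      : Fin m → Bool
        cols      : Fin n → Bool
        rows⊆S    : rows ⊆ S
        card-cols : card cols ≡ j
        no-edges  : ∀ a b → rows a ≡ true → cols b ≡ true → G a b ≡ false
        card-S≤   : card S ≤ (d * t) ^ j * card rows

    stage : 0 < card S → ∀ j → j ≤ t → Stage j
    stage _ zero _ = record
      { rows = S ; cols = λ _ → false ; rows⊆S = λ _ Sa → Sa ; card-cols = card-∅ n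
      ; no-edges = λ _ _ _ () ; card-S≤ = ≤-reflexive (sym (+-identityʳ (card S))) }
    stage 0<∣S∣ (suc j) j<t = extend (stage 0<∣S∣ j (<⇒≤ j<t))
      where
      extend : Stage j → Stage (suc j)
      extend σ = record
        { rows = rows′ ; cols = cols′ ; rows⊆S = λ a → rows⊆S a ∘ ∧-conicalˡ _ _
        ; card-cols = trans (card-updateAt-true cols b Tb) (cong suc card-cols)
        ; no-edges = no-edges′ ; card-S≤ = card-S≤′ }
        where
        open Stage σ
        0<∣rows∣ : 0 < card rows
        0<∣rows∣ = 0<m≤n*o⇒0<o ((d * t) ^ j) 0<∣S∣ card-S≤
        chosen = common-non-neighbour rows rows⊆S 0<∣rows∣ cols (subst (_< t) (sym card-cols) j<t)
        b = proj₁ chosen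
        Tb = proj₁ (proj₂ chosen)
        rows′ : Fin m → Bool
        rows′ a = rows a ∧ not (G a b)
        cols′ : Fin n → Bool
        cols′ = updateAt cols b (λ _ → true)
        no-edges′ : ∀ a b′ → rows′ a ≡ true → cols′ b′ ≡ true → G a b′ ≡ false
        no-edges′ a b′ rows′a cols′b′ with updateAt-true⁻ cols b b′ cols′b′
        ... | inj₁ colsb′ = no-edges a b′ (∧-conicalˡ _ _ rows′a) colsb′
        ... | inj₂ refl   = not-injective {y = false} (∧-conicalʳ _ _ rows′a)
        card-S≤′ : card S ≤ (d * t) ^ suc j * card rows′
        card-S≤′ = begin
          card S                              ≤⟨ card-S≤ ⟩
          (d * t) ^ j * card rows             ≤⟨ *-monoʳ-≤ ((d * t) ^ j) (proj₂ (proj₂ chosen)) ⟩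
          (d * t) ^ j * (d * t * card rows′)  ≡⟨ x∙yz≈y∙xz ((d * t) ^ j) (d * t) (card rows′) ⟩
          d * t * ((d * t) ^ j * card rows′)  ≡⟨ *-assoc (d * t) ((d * t) ^ j) (card rows′) ⟨
          (d * t) ^ suc j * card rows′        ∎

    card-rows<t : CoKttFree t G → (σ : Stage t) → card (Stage.rows σ) < t
    card-rows<t free σ = ≰⇒> λ t≤∣rows∣ → edge-within (subset-of-card rows t t≤∣rows∣)
      where
      open Stage σ
      edge-within : ∃[ A₀ ] (A₀ ⊆ rows × card A₀ ≡ t) → ⊥
      edge-within (A₀ , A₀⊆rows , ∣A₀∣≡t) with CoKttFree⇒edge free A₀ cols ∣A₀∣≡t card-cols
      ... | a , b , A₀a , colsb , Gab with trans (sym Gab) (no-edges a b (A₀⊆rows a A₀a) colsb)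
      ...   | ()

    card-S≤t*[d*t]^t : CoKttFree t G → card S ≤ t * (d * t) ^ t
    card-S≤t*[d*t]^t free with 0 <? card S
    ... | no  ∣S∣≯0 = ≤-trans (≮⇒≥ ∣S∣≯0) z≤n
    ... | yes 0<∣S∣ = begin
      card S                  ≤⟨ card-S≤ ⟩
      (d * t) ^ t * card rows  ≤⟨ *-monoʳ-≤ ((d * t) ^ t) (<⇒≤ (card-rows<t free σ)) ⟩
      (d * t) ^ t * t          ≡⟨ *-comm ((d * t) ^ t) t ⟩
      t * (d * t) ^ t          ∎
      where
      σ = stage 0<∣S∣ t ≤-refl
      open Stage σ

-- Rational inequalities are transported to ℚᵘ, where _≤_ unfolds to an inequality between
-- cross-multiplied integers.
module DensityInequalities where
  open import Data.Integer.Base as ℤ using (+_)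
  import Data.Integer.Properties as ℤ
  open import Data.Integer.Tactic.RingSolver using (solve-∀)
  open import Data.Nat.Base as ℕ using (ℕ; suc)
  import Data.Nat.Properties as ℕ
  open import Data.Nat.Coprimality using (Coprime; 1-coprimeTo; sym)
  open import Data.Rational.Base using (mkℚ; 1ℚ; _≤_; _*_; _-_; -_; toℚᵘ)
  open import Data.Rational.Properties
    using (normalize-coprime; toℚᵘ-mono-≤; toℚᵘ-homo-*; toℚᵘ-homo-+; toℚᵘ-homo‿-)
  open import Data.Rational.Unnormalised.Base as ℚᵘ using (mkℚᵘ; *≤*)
  import Data.Rational.Unnormalised.Properties as ℚᵘ
  open import Relation.Binary.PropositionalEquality
    using (_≡_; cong; cong₂; subst; subst₂; trans) renaming (sym to ≡-sym)
  open import Data.Product.Base using (_×_; _,_)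
  open import Defs using (ℚ[_])

  toℚᵘ-ℚ[] : ∀ k → toℚᵘ ℚ[ k ] ≡ mkℚᵘ (+ k) 0
  toℚᵘ-ℚ[] k = cong toℚᵘ (normalize-coprime (sym (1-coprimeTo k)))

  ℚ[]≤q*ℚ[]⇒ᵘ : ∀ q k n → ℚ[ k ] ≤ q * ℚ[ n ] → mkℚᵘ (+ k) 0 ℚᵘ.≤ toℚᵘ q ℚᵘ.* mkℚᵘ (+ n) 0
  ℚ[]≤q*ℚ[]⇒ᵘ q k n k≤qn =
    ℚᵘ.≤-respʳ-≃
      (ℚᵘ.≃-trans (toℚᵘ-homo-* q ℚ[ n ]) (ℚᵘ.*-congˡ {toℚᵘ q} (ℚᵘ.≃-reflexive (toℚᵘ-ℚ[] n))))
      (subst (ℚᵘ._≤ _) (toℚᵘ-ℚ[] k) (toℚᵘ-mono-≤ k≤qn))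

  module _ (p d-1 : ℕ) .(coprime : Coprime p (suc d-1)) where
    private
      ε = mkℚ (+ p) d-1 coprime
      d = suc d-1

    ℚ[]≤ε*ℚ[]⇒ : ∀ k n → ℚ[ k ] ≤ ε * ℚ[ n ] → k ℕ.* d ℕ.≤ p ℕ.* n
    ℚ[]≤ε*ℚ[]⇒ k n k≤εn with ℚ[]≤q*ℚ[]⇒ᵘ ε k n k≤εn
    ... | *≤* kd≤pn = ℤ.drop‿+≤+ (subst₂ ℤ._≤_ lhs rhs kd≤pn)
      where
      lhs : + k ℤ.* + (d ℕ.* 1) ≡ + (k ℕ.* d)
      lhs = trans (cong (λ e → + k ℤ.* + e) (ℕ.*-identityʳ d)) (≡-sym (ℤ.pos-* k d))
      rhs : (+ p ℤ.* + n) ℤ.* + 1 ≡ + (p ℕ.* n)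
      rhs = trans (ℤ.*-identityʳ (+ p ℤ.* + n)) (≡-sym (ℤ.pos-* p n))

    toℚᵘ-1-ε : toℚᵘ (1ℚ - ε) ℚᵘ.≃ ℚᵘ.1ℚᵘ ℚᵘ.- toℚᵘ ε
    toℚᵘ-1-ε = ℚᵘ.≃-trans (toℚᵘ-homo-+ 1ℚ (- ε)) (ℚᵘ.+-congʳ ℚᵘ.1ℚᵘ (toℚᵘ-homo‿- ε))

    ℚ[]≤[1-ε]*ℚ[]⇒ : ∀ k n → ℚ[ k ] ≤ (1ℚ - ε) * ℚ[ n ] → k ℕ.* d ℕ.+ p ℕ.* n ℕ.≤ d ℕ.* n
    ℚ[]≤[1-ε]*ℚ[]⇒ k n k≤[1-ε]n
      with ℚᵘ.≤-respʳ-≃ (ℚᵘ.*-congʳ toℚᵘ-1-ε) (ℚ[]≤q*ℚ[]⇒ᵘ (1ℚ - ε) k n k≤[1-ε]n)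
    ... | *≤* kd≤[d-p]n = ℤ.drop‿+≤+ (subst₂ ℤ._≤_ lhs rhs (ℤ.+-monoˡ-≤ (+ p ℤ.* + n) kd≤[d-p]n))
      where
      lhs : + k ℤ.* + (1 ℕ.* d ℕ.* 1) ℤ.+ + p ℤ.* + n ≡ + (k ℕ.* d ℕ.+ p ℕ.* n)
      lhs = trans (cong (λ e → + k ℤ.* + e ℤ.+ + p ℤ.* + n)
                        (trans (ℕ.*-identityʳ (1 ℕ.* d)) (ℕ.*-identityˡ d)))
              (≡-sym (trans (ℤ.pos-+ (k ℕ.* d) (p ℕ.* n)) (cong₂ ℤ._+_ (ℤ.pos-* k d) (ℤ.pos-* p n))))
      cancel-p : ∀ (d p n : ℤ.ℤ) →
                 ((+ 1 ℤ.* d ℤ.+ (ℤ.- p) ℤ.* + 1) ℤ.* n) ℤ.* + 1 ℤ.+ p ℤ.* n ≡ d ℤ.* n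
      cancel-p = solve-∀
      rhs : ((+ 1 ℤ.* + d ℤ.+ (ℤ.- + p) ℤ.* + 1) ℤ.* + n) ℤ.* + 1 ℤ.+ + p ℤ.* + n ≡ + (d ℕ.* n)
      rhs = trans (cancel-p (+ d) (+ p) (+ n)) (≡-sym (ℤ.pos-* d n))

    many-non-neighbours : .{{_ : ℕ.NonZero p}} → ∀ {t n deg nondeg} → deg ℕ.+ nondeg ≡ n →
                          ℚ[ t ] ≤ ε * ℚ[ n ] → ℚ[ deg ] ≤ (1ℚ - ε) * ℚ[ n ] →
                          t ℕ.≤ nondeg × n ℕ.≤ d ℕ.* nondeg
    many-non-neighbours {t} {n} {deg} {nondeg} deg+nondeg≡n t≤εn deg≤[1-ε]n = t≤nondeg , n≤d*nondeg
      where
      open ℕ.≤-Reasoning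
      p*n≤d*nondeg : p ℕ.* n ℕ.≤ d ℕ.* nondeg
      p*n≤d*nondeg = ℕ.+-cancelˡ-≤ (deg ℕ.* d) _ _ (begin
        deg ℕ.* d ℕ.+ p ℕ.* n       ≤⟨ ℚ[]≤[1-ε]*ℚ[]⇒ deg n deg≤[1-ε]n ⟩
        d ℕ.* n                      ≡⟨ cong (d ℕ.*_) deg+nondeg≡n ⟨
        d ℕ.* (deg ℕ.+ nondeg)       ≡⟨ ℕ.*-distribˡ-+ d deg nondeg ⟩
        d ℕ.* deg ℕ.+ d ℕ.* nondeg   ≡⟨ cong (ℕ._+ d ℕ.* nondeg) (ℕ.*-comm d deg) ⟩
        deg ℕ.* d ℕ.+ d ℕ.* nondeg   ∎)
      n≤d*nondeg : n ℕ.≤ d ℕ.* nondeg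
      n≤d*nondeg = ℕ.≤-trans (ℕ.m≤n*m n p) p*n≤d*nondeg
      t≤nondeg : t ℕ.≤ nondeg
      t≤nondeg = ℕ.*-cancelʳ-≤ t nondeg d (begin
        t ℕ.* d        ≤⟨ ℚ[]≤ε*ℚ[]⇒ t n t≤εn ⟩
        p ℕ.* n        ≤⟨ p*n≤d*nondeg ⟩
        d ℕ.* nondeg   ≡⟨ ℕ.*-comm d nondeg ⟩
        nondeg ℕ.* d   ∎)

open import Defs
open import Data.Nat using (ℕ; _≤_)
open import Data.Fin using (Fin)
open import Data.Vec using (tabulate; count)
open import Data.Product using (Σ)
open import Data.Rational using (ℚ; 0ℚ; 1ℚ; _<_; _*_; _-_) renaming (_≤_ to _≤ℚ_)
open import Data.Rational.Properties using (_≤?_)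

import Data.Nat as ℕ
open import Data.Integer.Base using (+_; -[1+_]; +<+)
open import Data.Product using (_×_; _,_)
open import Data.Rational using (mkℚ; ↧ₙ_; *<*)
open import Relation.Nullary.Decidable using (Dec; does; yes)
open import Relation.Binary.PropositionalEquality using (_≡_)
open import Data.Bool.Base using (Bool; true)
open import Data.Nat.Properties using (module ≤-Reasoning)
open ≤-Reasoning
open Cardinality using (card)
open CoKttFreeGraphs using (nondeg; count-tabulate; deg+nondeg; card-S≤t*[d*t]^t)
open DensityInequalities using (many-non-neighbours)

does≡true⇒ : ∀ {a} {A : Set a} (a? : Dec A) → does a? ≡ true → A
does≡true⇒ (yes a) _ = a

lemma1p6 : Σ (ℕ → ℚ → ℕ) λ C₁ →
    (t : ℕ) (ε : ℚ) → 0ℚ < ε → ε < 1ℚ →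
    (m n : ℕ) (G : BipGraph m n) → CoKttFree t G →
    ℚ[ t ] ≤ℚ ε * ℚ[ n ] →
    count (λ a → ℚ[ deg G a ] ≤? (1ℚ - ε) * ℚ[ n ]) (tabulate (λ (a : Fin m) → a)) ≤ C₁ t ε
lemma1p6 = C₁ , bound
  where
  C₁ : ℕ → ℚ → ℕ
  C₁ t ε = t ℕ.* (↧ₙ ε ℕ.* t) ℕ.^ t

  bound : (t : ℕ) (ε : ℚ) → 0ℚ < ε → ε < 1ℚ →
          (m n : ℕ) (G : BipGraph m n) → CoKttFree t G →
          ℚ[ t ] ≤ℚ ε * ℚ[ n ] →
          count (λ a → ℚ[ deg G a ] ≤? (1ℚ - ε) * ℚ[ n ]) (tabulate (λ (a : Fin m) → a)) ≤ C₁ t ε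
  bound t (mkℚ (+ 0)      _ _) (*<* (+<+ ()))
  bound t (mkℚ -[1+ _ ]   _ _) (*<* ())
  bound t ε@(mkℚ (+ ℕ.suc p) d-1 coprime) _ _ m n G free t≤εn = begin
    count low-degree? (tabulate (λ a → a))  ≡⟨ count-tabulate low-degree? (λ a → a) ⟩
    card S                                  ≤⟨ card-S≤t*[d*t]^t G t (ℕ.suc d-1) S S-large-nondeg free ⟩
    C₁ t ε                                  ∎
    where
    low-degree? : ∀ a → Dec (ℚ[ deg G a ] ≤ℚ (1ℚ - ε) * ℚ[ n ])
    low-degree? a = ℚ[ deg G a ] ≤? (1ℚ - ε) * ℚ[ n ]
    S : Fin m → Bool
    S a = does (low-degree? a)
    S-large-nondeg : ∀ a → S a ≡ true → t ≤ nondeg G a × n ≤ ℕ.suc d-1 ℕ.* nondeg G a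
    S-large-nondeg a Sa = many-non-neighbours (ℕ.suc p) d-1 coprime (deg+nondeg G a) t≤εn
                      (does≡true⇒ (low-degree? a) Sa)
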